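{- Let $n\ge 2$ and let $u,v$ be vertices of the Lucas cube $\Lambda_n$ with $d(u,v)=\operatorname{diam}(\Lambda_n)$. Then the number of shortest paths from $u$ to $v$ in $\Lambda_n$ equals $\frac{n}{2}E_{n-1}$ if $n$ is even, and $E_{n-1}$ if $n$ is odd, where $E_m$ denotes the $m$th Euler number.
   Context: For $n\ge1$, the hypercube $Q_n$ has vertex set $B_n=\{b_1\cdots b_n: b_i\in\{0,1\}\}$, two strings adjacent iff they differ in exactly one coordinate. The Lucas cube $\Lambda_n$ is the subgraph of $Q_n$ induced by the binary strings $b_1\cdots b_n$ with $b_ib_{i+1}=0$ for all $i\in\{1,\dots,n-1\}$ and additionally $b_1b_n=0$. $d(u,v)$ is the graph distance in $\Lambda_n$ and $\operatorname{diam}(\Lambda_n)$ its diameter. A permutation $\sigma_1\cdots\sigma_m$ of $\{1,\dots,m\}$ is alternating if $\sigma_1>\sigma_2<\sigma_3>\sigma_4<\cdots$; the Euler number $E_m$ is the number of alternating permutations of $\{1,\dots,m\}$ (with $E_0=1$), so $E_1=1,E_2=1,E_3=2,E_4=5,E_5=16$; equivalently $\sum_{m\ge0}E_mx^m/m!=\sec x+\tan x$. -}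

module Defs where

open import Data.Bool using (Bool; true; false; not; _∧_; T; if_then_else_)
import Data.Bool as Bool
open import Data.Nat using (ℕ; zero; suc; _+_; _*_; _<_; _≤_; _<ᵇ_)
open import Data.Fin using (Fin)
open import Data.Vec using (Vec; []; _∷_; updateAt; head; last)
open import Data.Vec.Properties using (≡-dec)
open import Data.Nat.ListAction using (sum)
open import Data.List using (List; []; _∷_; map; concatMap; filter; length; upTo; allFin)
open import Data.Product using (Σ; ∃; _×_; _,_)
open import Relation.Nullary using (¬_; does)
open import Relation.Binary.PropositionalEquality using (_≡_)

noConsec : ∀ {n} → Vec Bool n → Bool
noConsec []                = true
noConsec (x ∷ [])          = true
noConsec (x ∷ y ∷ xs)      = not (x ∧ y) ∧ noConsec (y ∷ xs)

isLucas : ∀ {n} → Vec Bool n → Bool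
isLucas []       = true
isLucas (x ∷ xs) = noConsec (x ∷ xs) ∧ not (x ∧ last (x ∷ xs))

Lucas : ∀ {n} → Vec Bool n → Set
Lucas b = T (isLucas b)

flipAt : ∀ {n} → Vec Bool n → Fin n → Vec Bool n
flipAt b i = updateAt b i not

Adj : ∀ {n} → Vec Bool n → Vec Bool n → Set
Adj {n} u w = Lucas u × Lucas w × Σ (Fin n) (λ i → w ≡ flipAt u i)

data Walk {n : ℕ} : Vec Bool n → Vec Bool n → ℕ → Set where
  stay : ∀ {u} → Lucas u → Walk u u 0
  step : ∀ {u w v k} → Adj u w → Walk w v k → Walk u v (suc k)

IsDist : ∀ {n} → Vec Bool n → Vec Bool n → ℕ → Set
IsDist u v k = Walk u v k × (∀ j → j < k → ¬ Walk u v j)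

IsDiam : ℕ → ℕ → Set
IsDiam n D =
  (Σ (Vec Bool n) λ u → Σ (Vec Bool n) λ v → IsDist u v D) ×
  (∀ (u v : Vec Bool n) (k : ℕ) → IsDist u v k → k ≤ D)

-- number of walks of length k from u to v in Λ_n (u assumed a vertex of Λ_n):
-- a walk of length suc k is a step to a neighbour flipAt u i (one per i,
-- distinct i give distinct neighbours) followed by a walk of length k.
-- For k = d(u,v) these walks are exactly the shortest u,v-paths.
numWalks : ∀ {n} → ℕ → Vec Bool n → Vec Bool n → ℕ
numWalks zero    u v = if does (≡-dec Bool._≟_ u v) then 1 else 0
numWalks {n} (suc k) u v =
  sum (map (λ i → if isLucas (flipAt u i) then numWalks k (flipAt u i) v else 0)
           (allFin n))

insertions : ℕ → List ℕ → List (List ℕ)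
insertions x []       = (x ∷ []) ∷ []
insertions x (y ∷ ys) = (x ∷ y ∷ ys) ∷ map (y ∷_) (insertions x ys)

perms : List ℕ → List (List ℕ)
perms []       = [] ∷ []
perms (x ∷ xs) = concatMap (insertions x) (perms xs)

-- σ₁ > σ₂ < σ₃ > σ₄ < ⋯  (down = next comparison must be a descent)
altFrom : Bool → List ℕ → Bool
altFrom d []           = true
altFrom d (x ∷ [])     = true
altFrom true  (x ∷ y ∷ r) = (y <ᵇ x) ∧ altFrom false (y ∷ r)
altFrom false (x ∷ y ∷ r) = (x <ᵇ y) ∧ altFrom true (y ∷ r)

alternating : List ℕ → Bool
alternating = altFrom true

oneTo : ℕ → List ℕ
oneTo m = map suc (upTo m)

Euler : ℕ → ℕ
Euler m = length (filter (λ σ → T? (alternating σ)) (perms (oneTo m)))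
  where
  open import Relation.Nullary.Decidable using () renaming (T? to T?)

-- Write the status of coordinate i on the way from u to v as remove (u_i = 1, v_i = 0),
-- add (u_i = 0, v_i = 1) or done.  A step flips one coordinate and changes one status;
-- removing a 1 never leaves Λ_n, and when nothing is to be removed every 1 of u lies in v,
-- so d(u,v) is the Hamming distance.  A shortest walk settles each pending coordinate once,
-- an add only after its neighbours to be removed: shortest walks are the linear extensions
-- of a fence poset on the cycle, whose elements alternate between remove and add.
-- For n = 2m the diameter n is attained only when every coordinate is pending; the first
-- step settles one of the m removes, leaving a zigzag path on n − 1 elements.  For odd n
-- the cycle cannot alternate, so the diameter is n − 1 and the fence is already a zigzag
-- path on n − 1 elements.  Inserting the earliest time into a permutation shows that the
-- linear extensions of a zigzag on k elements are the alternating permutations, E_k of them.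

module Submission where

open import Defs
open import Data.Bool using (Bool; true; false; not; _∧_; if_then_else_)
open import Data.Bool.Properties
  using (∧-assoc; ∧-comm; ∧-zeroʳ; ∧-identityʳ; ∧-inverseʳ; ∧-conicalˡ; ∧-conicalʳ;
         not-involutive; not-injective; if-eta; if-cong-then; T-≡; ⇔→≡)
import Data.Bool as Bool
open import Data.Nat using (ℕ; zero; suc; _+_; _*_; _∸_; _<_; _≤_; _<ᵇ_; _≡ᵇ_; z≤n; s≤s)
open import Data.Nat.Properties
  using (1+n≢n; +-0-commutativeMonoid; +-commutativeSemigroup; +-*-semiring; +-comm; +-suc; +-identityʳ;
         *-cancelˡ-≡; even≢odd; suc-injective; ≡ᵇ⇒≡; <⇒<ᵇ; <⇒≱; 1+n≰n; m≤n⇒m<n∨m≡n;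
         ≤-refl; ≤-reflexive; ≤-trans; ≤-antisym; ≤-pred; <-irrefl; +-mono-≤; n≤1+n; _<?_; ≮⇒≥)
open import Data.Fin using (Fin; zero; suc; toℕ; fromℕ; inject₁; opposite; _≟_)
open import Data.Fin.Properties using (toℕ-inject₁; opposite-involutive; any?)
open import Data.Fin.Relation.Unary.Top using (view; ‵fromℕ; ‵inj₁; view-fromℕ; view-inject₁)
open import Data.Fin.Permutation using (Permutation′; permutation; _⟨$⟩ʳ_; _∘ₚ_)
open import Data.Fin.Induction using (<-weakInduction)
open import Data.Vec using (Vec; []; _∷_; lookup; updateAt; zipWith; tabulate; last)
open import Data.Vec.Properties
  using (updateAt-updateAt; updateAt-cong; updateAt-id; lookup∘updateAt; lookup∘updateAt′;
         lookup-zipWith; lookup∘tabulate; ≡-dec)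
open import Data.Vec.Relation.Binary.Pointwise.Extensional using (ext; Pointwise-≡⇒≡)
open import Data.List using (List; []; _∷_; allFin)
open import Data.List.Relation.Unary.All using (All; []; _∷_)
import Data.List.Relation.Unary.All as All using (map)
import Data.List.Relation.Unary.All.Properties as All using (gmap⁺; concat⁺)
open import Relation.Nullary.Decidable using (T?)
import Data.List as List
open import Data.List.Properties using (map-tabulate; map-cong; map-cong-local; map-++; map-∘; length-map; length-upTo)
import Data.List.Relation.Unary.AllPairs.Properties as AllPairs using (map⁺; applyUpTo⁺₁)
open import Data.List.Relation.Unary.AllPairs using (AllPairs; []; _∷_)
open import Data.Nat.ListAction using () renaming (sum to sumList)
open import Data.Nat.ListAction.Properties using (sum-++)
open import Data.Product using (Σ; _×_; _,_; proj₁; proj₂)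
open import Data.Sum using (_⊎_; inj₁; inj₂; [_,_]′)
open import Data.Empty using (⊥-elim)
open import Data.Unit using (⊤; tt)
open import Function using (_∘_; _⇔_; mk⇔; Equivalence; Injection)
open import Function.Properties.Inverse using (↔⇒↣)
open import Function.Properties.Equivalence using () renaming (trans to ⇔-trans; sym to ⇔-sym)
open import Relation.Nullary using (yes; no)
open import Relation.Binary.PropositionalEquality
open import Algebra.Properties.CommutativeMonoid.Sum +-0-commutativeMonoid
  using (sum; sum-syntax; ∑-permute; ∑-distrib-+; sum-cong-≗; sum-replicate-zero)
open import Algebra.Properties.Semiring.Sum +-*-semiring using (*-distribʳ-sum)
open import Algebra.Properties.CommutativeSemigroup +-commutativeSemigroup using (x∙yz≈y∙xz)

prev : ∀ {n} → Fin n → Fin n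
prev {suc n} zero    = fromℕ n
prev {suc n} (suc i) = inject₁ i

next : ∀ {n} → Fin n → Fin n
next {suc n} i with view i
... | ‵fromℕ         = zero
... | ‵inj₁ {i = j} _ = suc j

next-fromℕ : ∀ n → next (fromℕ n) ≡ zero
next-fromℕ n rewrite view-fromℕ n = refl

next-inject₁ : ∀ {n} (i : Fin n) → next (inject₁ i) ≡ suc i
next-inject₁ i rewrite view-inject₁ i = refl

next-prev : ∀ {n} (i : Fin n) → next (prev i) ≡ i
next-prev {suc n} zero    = next-fromℕ n
next-prev {suc n} (suc i) = next-inject₁ i

prev-next : ∀ {n} (i : Fin n) → prev (next i) ≡ i
prev-next {suc n} i with view i
... | ‵fromℕ   = refl
... | ‵inj₁ _ = refl

next≢ : ∀ {n} (i : Fin (suc (suc n))) → next i ≢ i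
next≢ i with view i
... | ‵fromℕ          = λ ()
... | ‵inj₁ {i = j} _ = λ e → 1+n≢n (trans (cong toℕ e) (toℕ-inject₁ j))

prev≢ : ∀ {n} (i : Fin (suc (suc n))) → prev i ≢ i
prev≢ i e = next≢ i (trans (cong next (sym e)) (next-prev i))

opposite-inject₁ : ∀ {n} (i : Fin (suc n)) → opposite (inject₁ i) ≡ suc (opposite i)
opposite-inject₁ {zero}  zero    = refl
opposite-inject₁ {suc n} zero    = refl
opposite-inject₁ {suc n} (suc i) = cong inject₁ (opposite-inject₁ i)

opposite-fromℕ : ∀ n → opposite (fromℕ n) ≡ zero
opposite-fromℕ zero    = refl
opposite-fromℕ (suc n) = cong inject₁ (opposite-fromℕ n)

opposite-prev : ∀ {n} (i : Fin n) → opposite (prev i) ≡ next (opposite i)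
opposite-prev {suc n}       zero    = trans (opposite-fromℕ n) (sym (next-fromℕ n))
opposite-prev {suc (suc n)} (suc i) = trans (opposite-inject₁ i) (sym (next-inject₁ (opposite i)))

rotation : ∀ {n} → Permutation′ n
rotation = permutation next prev next-prev prev-next

reflection : ∀ {n} → Permutation′ n
reflection = permutation opposite opposite opposite-involutive opposite-involutive

IsRotation : ∀ {n} → Permutation′ n → Set
IsRotation π = ∀ i → π ⟨$⟩ʳ next i ≡ next (π ⟨$⟩ʳ i)

IsReflection : ∀ {n} → Permutation′ n → Set
IsReflection π = ∀ i → π ⟨$⟩ʳ next i ≡ prev (π ⟨$⟩ʳ i)

rotation-isRotation : ∀ {n} → IsRotation (rotation {n})
rotation-isRotation i = refl

reflection-isReflection : ∀ {n} → IsReflection (reflection {n})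
reflection-isReflection i = begin
  opposite (next i)                       ≡⟨ cong (λ k → opposite (next k)) (opposite-involutive i) ⟨
  opposite (next (opposite (opposite i))) ≡⟨ cong opposite (opposite-prev (opposite i)) ⟨
  opposite (opposite (prev (opposite i))) ≡⟨ opposite-involutive _ ⟩
  prev (opposite i)                       ∎
  where open ≡-Reasoning

rotation-onto : ∀ {m} (j : Fin (suc m)) → Σ (Permutation′ (suc m)) λ π → IsRotation π × π ⟨$⟩ʳ fromℕ m ≡ j
rotation-onto {m} = <-weakInduction RotatesLastTo (rotation , rotation-isRotation , next-fromℕ m) extend
  where
  RotatesLastTo : Fin (suc m) → Set
  RotatesLastTo j = Σ (Permutation′ (suc m)) λ π → IsRotation π × π ⟨$⟩ʳ fromℕ m ≡ j
  extend : ∀ i → RotatesLastTo (inject₁ i) → RotatesLastTo (suc i)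
  extend i (π , rot , π-fromℕ) = π ∘ₚ rotation , (λ k → cong next (rot k)) , trans (cong next π-fromℕ) (next-inject₁ i)
IsSymmetry : ∀ {n} → Permutation′ n → Set
IsSymmetry π = IsRotation π ⊎ IsReflection π

rotation-prev : ∀ {n} (π : Permutation′ n) → IsRotation π → ∀ i → π ⟨$⟩ʳ prev i ≡ prev (π ⟨$⟩ʳ i)
rotation-prev π rot i = begin
  π ⟨$⟩ʳ prev i                  ≡⟨ prev-next _ ⟨
  prev (next (π ⟨$⟩ʳ prev i))    ≡⟨ cong prev (rot (prev i)) ⟨
  prev (π ⟨$⟩ʳ next (prev i))    ≡⟨ cong (λ k → prev (π ⟨$⟩ʳ k)) (next-prev i) ⟩
  prev (π ⟨$⟩ʳ i)                ∎
  where open ≡-Reasoning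

reflection-prev : ∀ {n} (π : Permutation′ n) → IsReflection π → ∀ i → π ⟨$⟩ʳ prev i ≡ next (π ⟨$⟩ʳ i)
reflection-prev π ref i = begin
  π ⟨$⟩ʳ prev i                  ≡⟨ next-prev _ ⟨
  next (prev (π ⟨$⟩ʳ prev i))    ≡⟨ cong next (ref (prev i)) ⟨
  next (π ⟨$⟩ʳ next (prev i))    ≡⟨ cong (λ k → next (π ⟨$⟩ʳ k)) (next-prev i) ⟩
  next (π ⟨$⟩ʳ i)                ∎
  where open ≡-Reasoning

reflection-onto : ∀ {m} (j : Fin (suc m)) → Σ (Permutation′ (suc m)) λ π → IsReflection π × π ⟨$⟩ʳ fromℕ m ≡ j
reflection-onto {m} j with rotation-onto j
... | π , rot , π-fromℕ =
  (rotation ∘ₚ reflection) ∘ₚ π , reflects , trans (cong (λ k → π ⟨$⟩ʳ opposite k) (next-fromℕ m)) π-fromℕ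
  where
  reflects : ∀ i → π ⟨$⟩ʳ opposite (next (next i)) ≡ prev (π ⟨$⟩ʳ opposite (next i))
  reflects i = trans (cong (π ⟨$⟩ʳ_) (reflection-isReflection (next i))) (rotation-prev π rot (opposite (next i)))

symmetry-onto : ∀ {m} (j k : Fin (suc m)) → k ≡ next j ⊎ k ≡ prev j →
                Σ (Permutation′ (suc m)) λ π → IsSymmetry π × π ⟨$⟩ʳ fromℕ m ≡ j × π ⟨$⟩ʳ zero ≡ k
symmetry-onto {m} j k (inj₁ k≡next) with rotation-onto j
... | π , rot , π-fromℕ = π , inj₁ rot , π-fromℕ ,
  trans (cong (π ⟨$⟩ʳ_) (sym (next-fromℕ m))) (trans (rot (fromℕ m)) (trans (cong next π-fromℕ) (sym k≡next)))
symmetry-onto {m} j k (inj₂ k≡prev) with reflection-onto j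
... | π , ref , π-fromℕ = π , inj₂ ref , π-fromℕ ,
  trans (cong (π ⟨$⟩ʳ_) (sym (next-fromℕ m))) (trans (ref (fromℕ m)) (trans (cong prev π-fromℕ) (sym k≡prev)))

data Status : Set where
  remove add done : Status

status : Bool → Bool → Status
status true  false = remove
status false true  = add
status _     _     = done

statuses : ∀ {n} → Vec Bool n → Vec Bool n → Vec Status n
statuses = zipWith status

pending : Status → Bool
pending done = false
pending _    = true

isRemove : Status → Bool
isRemove remove = true
isRemove _      = false

𝟙 : Bool → ℕ
𝟙 true  = 1
𝟙 false = 0

pendingCount : ∀ {n} → Vec Status n → ℕ
pendingCount []      = 0
pendingCount (s ∷ W) = 𝟙 (pending s) + pendingCount W

settle : ∀ {n} → Vec Status n → Fin n → Vec Status n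
settle W i = updateAt W i (λ _ → done)

enabled : Status → Status → Status → Bool
enabled remove _ _ = true
enabled add    l r = not (isRemove l) ∧ not (isRemove r)
enabled done   _ _ = false

enabledAt : ∀ {n} → Vec Status n → Fin n → Bool
enabledAt W i = enabled (lookup W i) (lookup W (prev i)) (lookup W (next i))

-- The orders in which the pending entries of the cyclic word W can be settled one
-- at a time, an add entry only after its neighbours that still have to be removed.
extensions : ∀ {n} → ℕ → Vec Status n → ℕ
extensions     zero    W = 𝟙 (pendingCount W ≡ᵇ 0)
extensions {n} (suc k) W = ∑[ i < n ] (if enabledAt W i then extensions k (settle W i) else 0)

lookup-statuses : ∀ {n} (u v : Vec Bool n) i → lookup (statuses u v) i ≡ status (lookup u i) (lookup v i)
lookup-statuses u v i = lookup-zipWith status i u v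

lookup-settle : ∀ {n} (W : Vec Status n) i → lookup (settle W i) i ≡ done
lookup-settle W i = lookup∘updateAt i W

lookup-settle-≢ : ∀ {n} (W : Vec Status n) {i j} → j ≢ i → lookup (settle W i) j ≡ lookup W j
lookup-settle-≢ W {i} {j} j≢i = lookup∘updateAt′ j i j≢i W

pendingCount-settle : ∀ {n} (W : Vec Status n) i → pendingCount W ≡ 𝟙 (pending (lookup W i)) + pendingCount (settle W i)
pendingCount-settle (s ∷ W) zero    = refl
pendingCount-settle (s ∷ W) (suc i) =
  trans (cong (𝟙 (pending s) +_) (pendingCount-settle W i))
        (x∙yz≈y∙xz (𝟙 (pending s)) (𝟙 (pending (lookup W i))) (pendingCount (settle W i)))

pendingCount-settle-pending : ∀ {n} (W : Vec Status n) i → pending (lookup W i) ≡ true → pendingCount W ≡ suc (pendingCount (settle W i))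
pendingCount-settle-pending W i p = trans (pendingCount-settle W i) (cong (λ b → 𝟙 b + pendingCount (settle W i)) p)

pendingCount-statuses-self : ∀ {n} (w : Vec Bool n) → pendingCount (statuses w w) ≡ 0
pendingCount-statuses-self []          = refl
pendingCount-statuses-self (true ∷ w)  = pendingCount-statuses-self w
pendingCount-statuses-self (false ∷ w) = pendingCount-statuses-self w

pendingCount-statuses≡0 : ∀ {n} (u v : Vec Bool n) → pendingCount (statuses u v) ≡ 0 → u ≡ v
pendingCount-statuses≡0 []          []          _ = refl
pendingCount-statuses≡0 (true ∷ u)  (true ∷ v)  p = cong (true ∷_) (pendingCount-statuses≡0 u v p)
pendingCount-statuses≡0 (false ∷ u) (false ∷ v) p = cong (false ∷_) (pendingCount-statuses≡0 u v p)

vec-ext : ∀ {A : Set} {n} {xs ys : Vec A n} → (∀ i → lookup xs i ≡ lookup ys i) → xs ≡ ys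
vec-ext h = Pointwise-≡⇒≡ (ext h)

lookup-flipAt : ∀ {n} (w : Vec Bool n) i → lookup (flipAt w i) i ≡ not (lookup w i)
lookup-flipAt w i = lookup∘updateAt i w

lookup-flipAt-≢ : ∀ {n} (w : Vec Bool n) {i j} → j ≢ i → lookup (flipAt w i) j ≡ lookup w j
lookup-flipAt-≢ w {i} {j} j≢i = lookup∘updateAt′ j i j≢i w

flipAt-involutive : ∀ {n} (w : Vec Bool n) i → flipAt (flipAt w i) i ≡ w
flipAt-involutive w i = trans (updateAt-updateAt i w) (trans (updateAt-cong i not-involutive w) (updateAt-id i w))

status-not : ∀ a b → pending (status (not a) b) ≡ not (pending (status a b))
status-not true  true  = refl
status-not true  false = refl
status-not false true  = refl
status-not false false = refl

status-not-pending : ∀ a b → pending (status a b) ≡ true → status (not a) b ≡ done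
status-not-pending true  false _ = refl
status-not-pending false true  _ = refl

statuses-flipAt : ∀ {n} (u v : Vec Bool n) i → pending (lookup (statuses u v) i) ≡ true →
                  statuses (flipAt u i) v ≡ settle (statuses u v) i
statuses-flipAt u v i p = vec-ext entry
  where
  entry : ∀ j → lookup (statuses (flipAt u i) v) j ≡ lookup (settle (statuses u v) i) j
  entry j with j ≟ i
  ... | yes refl = begin
    lookup (statuses (flipAt u j) v) j            ≡⟨ lookup-statuses (flipAt u j) v j ⟩
    status (lookup (flipAt u j) j) (lookup v j)   ≡⟨ cong (λ a → status a (lookup v j)) (lookup-flipAt u j) ⟩
    status (not (lookup u j)) (lookup v j)        ≡⟨ status-not-pending (lookup u j) _ (trans (cong pending (sym (lookup-statuses u v j))) p) ⟩
    done                                          ≡⟨ lookup-settle (statuses u v) j ⟨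
    lookup (settle (statuses u v) j) j            ∎
    where open ≡-Reasoning
  ... | no j≢i = begin
    lookup (statuses (flipAt u i) v) j            ≡⟨ lookup-statuses (flipAt u i) v j ⟩
    status (lookup (flipAt u i) j) (lookup v j)   ≡⟨ cong (λ a → status a (lookup v j)) (lookup-flipAt-≢ u j≢i) ⟩
    status (lookup u j) (lookup v j)              ≡⟨ lookup-statuses u v j ⟨
    lookup (statuses u v) j                       ≡⟨ lookup-settle-≢ (statuses u v) j≢i ⟨
    lookup (settle (statuses u v) i) j            ∎
    where open ≡-Reasoning

pendingCount-flipAt-pending : ∀ {n} (u v : Vec Bool n) i → pending (lookup (statuses u v) i) ≡ true →
                              pendingCount (statuses u v) ≡ suc (pendingCount (statuses (flipAt u i) v))
pendingCount-flipAt-pending u v i p =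
  trans (pendingCount-settle-pending (statuses u v) i p) (cong (λ W → suc (pendingCount W)) (sym (statuses-flipAt u v i p)))

pendingCount-flipAt-done : ∀ {n} (u v : Vec Bool n) i → pending (lookup (statuses u v) i) ≡ false →
                           pendingCount (statuses (flipAt u i) v) ≡ suc (pendingCount (statuses u v))
pendingCount-flipAt-done u v i p = begin
  pendingCount (statuses (flipAt u i) v)                        ≡⟨ pendingCount-flipAt-pending (flipAt u i) v i flipped-pending ⟩
  suc (pendingCount (statuses (flipAt (flipAt u i) i) v))       ≡⟨ cong (λ w → suc (pendingCount (statuses w v))) (flipAt-involutive u i) ⟩
  suc (pendingCount (statuses u v))                             ∎
  where
  open ≡-Reasoning
  flipped-pending : pending (lookup (statuses (flipAt u i) v) i) ≡ true
  flipped-pending = begin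
    pending (lookup (statuses (flipAt u i) v) i)            ≡⟨ cong pending (lookup-statuses (flipAt u i) v i) ⟩
    pending (status (lookup (flipAt u i) i) (lookup v i))   ≡⟨ cong (λ a → pending (status a (lookup v i))) (lookup-flipAt u i) ⟩
    pending (status (not (lookup u i)) (lookup v i))        ≡⟨ status-not (lookup u i) (lookup v i) ⟩
    not (pending (status (lookup u i) (lookup v i)))        ≡⟨ cong (λ s → not (pending s)) (lookup-statuses u v i) ⟨
    not (pending (lookup (statuses u v) i))                 ≡⟨ cong not p ⟩
    true                                                    ∎

pendingCount-flipAt-≤ : ∀ {n} (u v : Vec Bool n) i → pendingCount (statuses u v) ≤ suc (pendingCount (statuses (flipAt u i) v))
pendingCount-flipAt-≤ u v i with pending (lookup (statuses u v) i) in p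
... | true  = ≤-reflexive (pendingCount-flipAt-pending u v i p)
... | false = ≤-trans (≤-trans (n≤1+n _) (n≤1+n _)) (≤-reflexive (cong suc (sym (pendingCount-flipAt-done u v i p))))

-- Independent sets of the cycle

Independent : ∀ {n} → Vec Bool n → Set
Independent w = ∀ i → lookup w i ∧ lookup w (next i) ≡ false

last≡lookup-fromℕ : ∀ {n} (w : Vec Bool (suc n)) → last w ≡ lookup w (fromℕ n)
last≡lookup-fromℕ (x ∷ [])    = refl
last≡lookup-fromℕ (x ∷ y ∷ w) = last≡lookup-fromℕ (y ∷ w)

noConsec⇒ : ∀ {n} (w : Vec Bool (suc n)) → noConsec w ≡ true → ∀ j → lookup w (inject₁ j) ∧ lookup w (suc j) ≡ false
noConsec⇒ (x ∷ y ∷ w) p zero    = not-injective (∧-conicalˡ _ _ p)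
noConsec⇒ (x ∷ y ∷ w) p (suc j) = noConsec⇒ (y ∷ w) (∧-conicalʳ _ _ p) j

⇒noConsec : ∀ {n} (w : Vec Bool (suc n)) → (∀ j → lookup w (inject₁ j) ∧ lookup w (suc j) ≡ false) → noConsec w ≡ true
⇒noConsec (x ∷ [])    h = refl
⇒noConsec (x ∷ y ∷ w) h = cong₂ _∧_ (cong not (h zero)) (⇒noConsec (y ∷ w) (λ j → h (suc j)))

isLucas⇒independent : ∀ {n} (w : Vec Bool n) → isLucas w ≡ true → Independent w
isLucas⇒independent {suc n} (x ∷ w) p i with view i
... | ‵fromℕ = begin
  lookup (x ∷ w) (fromℕ n) ∧ x   ≡⟨ ∧-comm _ x ⟩
  x ∧ lookup (x ∷ w) (fromℕ n)   ≡⟨ cong (x ∧_) (last≡lookup-fromℕ (x ∷ w)) ⟨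
  x ∧ last (x ∷ w)               ≡⟨ not-injective (∧-conicalʳ _ _ p) ⟩
  false                          ∎
  where open ≡-Reasoning
... | ‵inj₁ {i = j} _ = noConsec⇒ (x ∷ w) (∧-conicalˡ _ _ p) j

independent⇒isLucas : ∀ {n} (w : Vec Bool n) → Independent w → isLucas w ≡ true
independent⇒isLucas []               _   = refl
independent⇒isLucas {suc n} (x ∷ w) ind = cong₂ _∧_ consecutive (cong not wraparound)
  where
  consecutive : noConsec (x ∷ w) ≡ true
  consecutive = ⇒noConsec (x ∷ w) λ j →
    subst (λ k → lookup (x ∷ w) (inject₁ j) ∧ lookup (x ∷ w) k ≡ false) (next-inject₁ j) (ind (inject₁ j))
  wraparound : x ∧ last (x ∷ w) ≡ false
  wraparound = begin
    x ∧ last (x ∷ w)                       ≡⟨ cong (x ∧_) (last≡lookup-fromℕ (x ∷ w)) ⟩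
    x ∧ lookup (x ∷ w) (fromℕ n)           ≡⟨ ∧-comm x _ ⟩
    lookup (x ∷ w) (fromℕ n) ∧ x           ≡⟨ cong (λ k → lookup (x ∷ w) (fromℕ n) ∧ lookup (x ∷ w) k) (next-fromℕ n) ⟨
    lookup (x ∷ w) (fromℕ n) ∧ lookup (x ∷ w) (next (fromℕ n)) ≡⟨ ind (fromℕ n) ⟩
    false                                  ∎
    where open ≡-Reasoning

isLucas⇔independent : ∀ {n} (w : Vec Bool n) → isLucas w ≡ true ⇔ Independent w
isLucas⇔independent w = mk⇔ (isLucas⇒independent w) (independent⇒isLucas w)

independent-⊆ : ∀ {n} (w w′ : Vec Bool n) → Independent w → (∀ j → lookup w′ j ≡ true → lookup w j ≡ true) → Independent w′
independent-⊆ w w′ ind w′⊆w j with lookup w′ j in e₁ | lookup w′ (next j) in e₂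
... | false | _     = refl
... | true  | false = refl
... | true  | true  with () ← trans (sym (cong₂ _∧_ (w′⊆w j e₁) (w′⊆w (next j) e₂))) (ind j)

independent-neighbours : ∀ {n} (w : Vec Bool n) → Independent w → ∀ i → lookup w i ≡ true →
                         lookup w (prev i) ≡ false × lookup w (next i) ≡ false
independent-neighbours w ind i wᵢ = absent-before , trans (cong (_∧ lookup w (next i)) (sym wᵢ)) (ind i)
  where
  open ≡-Reasoning
  absent-before : lookup w (prev i) ≡ false
  absent-before = begin
    lookup w (prev i)                              ≡⟨ ∧-identityʳ _ ⟨
    lookup w (prev i) ∧ true                       ≡⟨ cong (lookup w (prev i) ∧_) wᵢ ⟨
    lookup w (prev i) ∧ lookup w i                 ≡⟨ cong (λ k → lookup w (prev i) ∧ lookup w k) (next-prev i) ⟨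
    lookup w (prev i) ∧ lookup w (next (prev i))   ≡⟨ ind (prev i) ⟩
    false                                          ∎

flipAt-independent⇔ : ∀ {n} (w : Vec Bool (suc (suc n))) i → Independent w → lookup w i ≡ false →
                      Independent (flipAt w i) ⇔ (lookup w (prev i) ≡ false × lookup w (next i) ≡ false)
flipAt-independent⇔ w i ind wᵢ = mk⇔ neighbours-absent independent
  where
  flipped : lookup (flipAt w i) i ≡ true
  flipped = trans (lookup-flipAt w i) (cong not wᵢ)
  neighbours-absent : Independent (flipAt w i) → lookup w (prev i) ≡ false × lookup w (next i) ≡ false
  neighbours-absent ind′ with independent-neighbours (flipAt w i) ind′ i flipped
  ... | f-prev , f-next = trans (sym (lookup-flipAt-≢ w (prev≢ i))) f-prev , trans (sym (lookup-flipAt-≢ w (next≢ i))) f-next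
  independent : lookup w (prev i) ≡ false × lookup w (next i) ≡ false → Independent (flipAt w i)
  independent (w-prev , w-next) j with j ≟ i
  ... | yes refl = trans (cong₂ _∧_ flipped (lookup-flipAt-≢ w (next≢ j))) w-next
  ... | no j≢i with next j ≟ i
  ...   | yes refl = cong (_∧ lookup (flipAt w (next j)) (next j))
                          (trans (lookup-flipAt-≢ w j≢i) (trans (cong (lookup w) (sym (prev-next j))) w-prev))
  ...   | no nj≢i  = trans (cong₂ _∧_ (lookup-flipAt-≢ w j≢i) (lookup-flipAt-≢ w nj≢i)) (ind j)

isRemove-status-false : ∀ a → isRemove (status a false) ≡ a
isRemove-status-false true  = refl
isRemove-status-false false = refl

not∧not≡true⇔ : ∀ {a b} → not a ∧ not b ≡ true ⇔ (a ≡ false × b ≡ false)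
not∧not≡true⇔ {false} {false} = mk⇔ (λ _ → refl , refl) (λ _ → refl)
not∧not≡true⇔ {false} {true}  = mk⇔ (λ ()) (λ ())
not∧not≡true⇔ {true}  {b}     = mk⇔ (λ ()) (λ ())

flipAt-⊆ : ∀ {n} (u : Vec Bool n) i → lookup u i ≡ true → ∀ j → lookup (flipAt u i) j ≡ true → lookup u j ≡ true
flipAt-⊆ u i uᵢ j e with j ≟ i
... | yes refl with () ← trans (sym e) (trans (lookup-flipAt u j) (cong not uᵢ))
... | no j≢i = trans (sym (lookup-flipAt-≢ u j≢i)) e

isLucas-flipAt-remove : ∀ {n} (u : Vec Bool n) i → Independent u → lookup u i ≡ true → isLucas (flipAt u i) ≡ true
isLucas-flipAt-remove u i ind uᵢ = independent⇒isLucas (flipAt u i) (independent-⊆ u (flipAt u i) ind (flipAt-⊆ u i uᵢ))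

isLucas-flipAt-add : ∀ {n} (u v : Vec Bool (suc (suc n))) i → Independent u → Independent v → lookup u i ≡ false → lookup v i ≡ true →
  isLucas (flipAt u i) ≡ enabled add (status (lookup u (prev i)) (lookup v (prev i))) (status (lookup u (next i)) (lookup v (next i)))
isLucas-flipAt-add u v i indᵤ indᵥ uᵢ vᵢ = begin
  isLucas (flipAt u i)
    ≡⟨ ⇔→≡ (⇔-trans (isLucas⇔independent (flipAt u i))
                     (⇔-trans (flipAt-independent⇔ u i indᵤ uᵢ) (⇔-sym not∧not≡true⇔))) ⟩
  not (lookup u (prev i)) ∧ not (lookup u (next i))
    ≡⟨ cong₂ (λ a b → not a ∧ not b) (isRemove-status-false (lookup u (prev i))) (isRemove-status-false (lookup u (next i))) ⟨
  not (isRemove (status (lookup u (prev i)) false)) ∧ not (isRemove (status (lookup u (next i)) false))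
    ≡⟨ cong₂ (λ a b → not (isRemove (status (lookup u (prev i)) a)) ∧ not (isRemove (status (lookup u (next i)) b))) v-prev v-next ⟨
  enabled add (status (lookup u (prev i)) (lookup v (prev i))) (status (lookup u (next i)) (lookup v (next i))) ∎
  where
  open ≡-Reasoning
  v-prev : lookup v (prev i) ≡ false
  v-prev = proj₁ (independent-neighbours v indᵥ i vᵢ)
  v-next : lookup v (next i) ≡ false
  v-next = proj₂ (independent-neighbours v indᵥ i vᵢ)

enabledAt-statuses : ∀ {n} (u v : Vec Bool n) i → enabledAt (statuses u v) i ≡
  enabled (status (lookup u i) (lookup v i)) (status (lookup u (prev i)) (lookup v (prev i))) (status (lookup u (next i)) (lookup v (next i)))
enabledAt-statuses u v i = cong₂ (λ s (lr : Status × Status) → enabled s (proj₁ lr) (proj₂ lr))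
  (lookup-statuses u v i) (cong₂ _,_ (lookup-statuses u v (prev i)) (lookup-statuses u v (next i)))

isLucas-flipAt : ∀ {n} (u v : Vec Bool (suc (suc n))) i → Independent u → Independent v →
                 pending (lookup (statuses u v) i) ≡ true → isLucas (flipAt u i) ≡ enabledAt (statuses u v) i
isLucas-flipAt u v i indᵤ indᵥ p rewrite enabledAt-statuses u v i | lookup-statuses u v i
  with lookup u i in uᵢ | lookup v i in vᵢ
... | true  | false = isLucas-flipAt-remove u i indᵤ uᵢ
... | false | true  = isLucas-flipAt-add u v i indᵤ indᵥ uᵢ vᵢ

lucas : ∀ {n} (w : Vec Bool n) → Independent w → Lucas w
lucas w ind = Equivalence.from T-≡ (independent⇒isLucas w ind)

lucas⇒independent : ∀ {n} (w : Vec Bool n) → Lucas w → Independent w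
lucas⇒independent w l = isLucas⇒independent w (Equivalence.to T-≡ l)

-- Distance in the Lucas cube

walk-pendingCount-≤ : ∀ {n} {u v : Vec Bool n} {k} → Walk u v k → pendingCount (statuses u v) ≤ k
walk-pendingCount-≤ {u = u}     (stay _)                  = ≤-reflexive (pendingCount-statuses-self u)
walk-pendingCount-≤ {u = u} {v} (step (_ , _ , i , refl) w) = ≤-trans (pendingCount-flipAt-≤ u v i) (s≤s (walk-pendingCount-≤ w))

pending-exists : ∀ {n} (W : Vec Status n) {k} → pendingCount W ≡ suc k → Σ (Fin n) λ i → pending (lookup W i) ≡ true
pending-exists (remove ∷ W) p = zero , refl
pending-exists (add    ∷ W) p = zero , refl
pending-exists (done   ∷ W) p with pending-exists W p
... | i , pᵢ = suc i , pᵢ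

status-remove : ∀ {a b} → isRemove (status a b) ≡ true → a ≡ true
status-remove {true}  {false} _ = refl
status-remove {true}  {true}  ()
status-remove {false} {true}  ()
status-remove {false} {false} ()

status-not-remove : ∀ {a b} → isRemove (status a b) ≡ false → a ≡ true → b ≡ true
status-not-remove {true} {true}  _  _ = refl
status-not-remove {true} {false} () _

status-pending-false : ∀ {a b} → pending (status a b) ≡ true → a ≡ false → b ≡ true
status-pending-false {false} {true}  _  _ = refl
status-pending-false {false} {false} () _

-- Removing a 1 of u keeps it independent; when nothing is to be removed, u ⊆ v,
-- and adding any pending coordinate keeps u inside v.
pending-flippable : ∀ {n} (u v : Vec Bool n) {k} → Independent u → Independent v → pendingCount (statuses u v) ≡ suc k →
                    Σ (Fin n) λ i → pending (lookup (statuses u v) i) ≡ true × Independent (flipAt u i)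
pending-flippable u v indᵤ indᵥ p with any? (λ i → isRemove (lookup (statuses u v) i) Bool.≟ true)
... | yes (i , r) = i , removing , independent-⊆ u (flipAt u i) indᵤ (flipAt-⊆ u i uᵢ)
  where
  uᵢ : lookup u i ≡ true
  uᵢ = status-remove (trans (cong isRemove (sym (lookup-statuses u v i))) r)
  removing : pending (lookup (statuses u v) i) ≡ true
  removing with lookup (statuses u v) i
  ... | remove = refl
... | no no-remove with pending-exists (statuses u v) p
...   | i , pᵢ = i , pᵢ , independent-⊆ v (flipAt u i) indᵥ flipped⊆v
  where
  not-remove : ∀ j → isRemove (status (lookup u j) (lookup v j)) ≡ false
  not-remove j with isRemove (status (lookup u j) (lookup v j)) in r
  ... | true  = ⊥-elim (no-remove (j , trans (cong isRemove (lookup-statuses u v j)) r))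
  ... | false = refl
  flipped⊆v : ∀ j → lookup (flipAt u i) j ≡ true → lookup v j ≡ true
  flipped⊆v j e with j ≟ i
  ... | yes refl = status-pending-false (trans (cong pending (sym (lookup-statuses u v j))) pᵢ)
                     (not-injective (trans (sym (lookup-flipAt u j)) e))
  ... | no j≢i = status-not-remove (not-remove j) (trans (sym (lookup-flipAt-≢ u j≢i)) e)

walk-of-pendingCount : ∀ {n} k (u v : Vec Bool n) → Independent u → Independent v → pendingCount (statuses u v) ≡ k → Walk u v k
walk-of-pendingCount zero u v indᵤ indᵥ p with pendingCount-statuses≡0 u v p
... | refl = stay (lucas u indᵤ)
walk-of-pendingCount (suc k) u v indᵤ indᵥ p with pending-flippable u v indᵤ indᵥ p
... | i , pᵢ , ind′ = step (lucas u indᵤ , lucas (flipAt u i) ind′ , i , refl)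
  (walk-of-pendingCount k (flipAt u i) v ind′ indᵥ (suc-injective (trans (sym (pendingCount-flipAt-pending u v i pᵢ)) p)))

distance≡pendingCount : ∀ {n} (u v : Vec Bool n) {k} → Independent u → Independent v → IsDist u v k → k ≡ pendingCount (statuses u v)
distance≡pendingCount u v indᵤ indᵥ (walk , shortest) with pendingCount (statuses u v) <? _
... | yes shorter = ⊥-elim (shortest _ shorter (walk-of-pendingCount _ u v indᵤ indᵥ refl))
... | no ¬shorter = ≤-antisym (≮⇒≥ ¬shorter) (walk-pendingCount-≤ walk)

sum-tabulate : ∀ {n} (f : Fin n → ℕ) → sumList (List.tabulate f) ≡ ∑[ i < n ] f i
sum-tabulate {zero}  f = refl
sum-tabulate {suc n} f = cong (f zero +_) (sum-tabulate (λ i → f (suc i)))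

sum-allFin : ∀ {n} (f : Fin n → ℕ) → sumList (List.map f (allFin n)) ≡ ∑[ i < n ] f i
sum-allFin f = trans (cong sumList (map-tabulate (λ i → i) f)) (sum-tabulate f)

numWalks-< : ∀ {n} k (u v : Vec Bool n) → k < pendingCount (statuses u v) → numWalks k u v ≡ 0
numWalks-< zero u v lt with ≡-dec Bool._≟_ u v
... | yes refl = ⊥-elim (<-irrefl (sym (pendingCount-statuses-self u)) lt)
... | no _     = refl
numWalks-< {n} (suc k) u v lt = begin
  numWalks (suc k) u v                                                             ≡⟨ sum-allFin {n} _ ⟩
  ∑[ i < n ] (if isLucas (flipAt u i) then numWalks k (flipAt u i) v else 0)       ≡⟨ sum-cong-≗ no-walk ⟩
  ∑[ i < n ] 0                                                                     ≡⟨ sum-replicate-zero n ⟩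
  0                                                                                ∎
  where
  open ≡-Reasoning
  no-walk : ∀ i → (if isLucas (flipAt u i) then numWalks k (flipAt u i) v else 0) ≡ 0
  no-walk i = trans (if-cong-then (isLucas (flipAt u i)) (numWalks-< k (flipAt u i) v (≤-pred (≤-trans lt (pendingCount-flipAt-≤ u v i)))))
                    (if-eta (isLucas (flipAt u i)))

pending-false : ∀ {s} → pending s ≡ false → s ≡ done
pending-false {done} _ = refl

numWalks≡extensions : ∀ {n} k (u v : Vec Bool (suc (suc n))) → Independent u → Independent v →
                      k ≤ pendingCount (statuses u v) → numWalks k u v ≡ extensions k (statuses u v)
numWalks≡extensions zero u v _ _ _ with ≡-dec Bool._≟_ u v
... | yes refl = cong (λ p → 𝟙 (p ≡ᵇ 0)) (sym (pendingCount-statuses-self u))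
... | no u≢v with pendingCount (statuses u v) ≡ᵇ 0 in p
...   | true  = ⊥-elim (u≢v (pendingCount-statuses≡0 u v (≡ᵇ⇒≡ _ 0 (Equivalence.from T-≡ p))))
...   | false = refl
numWalks≡extensions {n} (suc k) u v indᵤ indᵥ k<p =
  trans (sum-allFin {suc (suc n)} (λ i → if isLucas (flipAt u i) then numWalks k (flipAt u i) v else 0)) (sum-cong-≗ termwise)
  where
  W = statuses u v
  termwise : ∀ i → (if isLucas (flipAt u i) then numWalks k (flipAt u i) v else 0) ≡
                   (if enabledAt W i then extensions k (settle W i) else 0)
  termwise i with pending (lookup W i) in pᵢ
  ... | false rewrite pending-false pᵢ =
    trans (if-cong-then (isLucas (flipAt u i))
            (numWalks-< k (flipAt u i) v (≤-trans k<p (≤-trans (n≤1+n _) (≤-reflexive (sym (pendingCount-flipAt-done u v i pᵢ)))))))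
          (if-eta (isLucas (flipAt u i)))
  ... | true rewrite isLucas-flipAt u v i indᵤ indᵥ pᵢ with enabledAt W i in eᵢ
  ...   | false = refl
  ...   | true  = trans (numWalks≡extensions k (flipAt u i) v flipped-independent indᵥ
                          (≤-pred (≤-trans k<p (≤-reflexive (pendingCount-flipAt-pending u v i pᵢ)))))
                        (cong (extensions k) (statuses-flipAt u v i pᵢ))
    where
    flipped-independent : Independent (flipAt u i)
    flipped-independent = isLucas⇒independent (flipAt u i) (trans (isLucas-flipAt u v i indᵤ indᵥ pᵢ) eᵢ)

-- Alternating permutations and linear extensions of a path

count : ∀ {A : Set} → (A → Bool) → List A → ℕ
count P xs = sumList (List.map (λ x → 𝟙 (P x)) xs)

count-cong : ∀ {A : Set} {P P′ : A → Bool} → (∀ x → P x ≡ P′ x) → ∀ xs → count P xs ≡ count P′ xs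
count-cong eq xs = cong sumList (map-cong (λ x → cong 𝟙 (eq x)) xs)

count-cong-local : ∀ {A : Set} {P P′ : A → Bool} {xs} → All (λ x → P x ≡ P′ x) xs → count P xs ≡ count P′ xs
count-cong-local eqs = cong sumList (map-cong-local (All.map (cong 𝟙) eqs))

count-map : ∀ {A B : Set} (P : B → Bool) (f : A → B) xs → count P (List.map f xs) ≡ count (λ x → P (f x)) xs
count-map P f xs = cong sumList (sym (map-∘ xs))

count-++ : ∀ {A : Set} (P : A → Bool) xs ys → count P (xs List.++ ys) ≡ count P xs + count P ys
count-++ P xs ys = trans (cong sumList (map-++ (λ x → 𝟙 (P x)) xs ys)) (sum-++ (List.map (λ x → 𝟙 (P x)) xs) _)

count-concatMap : ∀ {A B : Set} (P : B → Bool) (f : A → List B) xs →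
                  count P (List.concatMap f xs) ≡ sumList (List.map (λ x → count P (f x)) xs)
count-concatMap P f []       = refl
count-concatMap P f (x ∷ xs) = trans (count-++ P (f x) _) (cong (count P (f x) +_) (count-concatMap P f xs))

length-filter : ∀ {A : Set} (P : A → Bool) xs → List.length (List.filter (λ x → T? (P x)) xs) ≡ count P xs
length-filter P []       = refl
length-filter P (x ∷ xs) with P x
... | true  = cong suc (length-filter P xs)
... | false = length-filter P xs

sumList-∑-comm : ∀ {A : Set} {n} (g : A → Fin n → ℕ) xs →
                 sumList (List.map (λ x → ∑[ i < n ] g x i) xs) ≡ ∑[ i < n ] sumList (List.map (λ x → g x i) xs)
sumList-∑-comm {n = n} g []       = sym (sum-replicate-zero n)
sumList-∑-comm         g (x ∷ xs) = trans (cong (sum (g x) +_) (sumList-∑-comm g xs)) (sym (∑-distrib-+ (g x) _))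

insertions-All : ∀ {P : ℕ → Set} {x σ} → P x → All P σ → All (All P) (insertions x σ)
insertions-All px []        = (px ∷ []) ∷ []
insertions-All px (py ∷ ps) = (px ∷ py ∷ ps) ∷ All.gmap⁺ (py ∷_) (insertions-All px ps)

perms-All : ∀ {P : ℕ → Set} {xs} → All P xs → All (All P) (perms xs)
perms-All []        = [] ∷ []
perms-All (px ∷ ps) = All.concat⁺ (All.gmap⁺ (insertions-All px) (perms-All ps))

insertions-length : ∀ x σ → All (λ τ → List.length τ ≡ suc (List.length σ)) (insertions x σ)
insertions-length x []      = refl ∷ []
insertions-length x (y ∷ σ) = refl ∷ All.gmap⁺ (cong suc) (insertions-length x σ)

perms-length : ∀ xs → All (λ σ → List.length σ ≡ List.length xs) (perms xs)
perms-length []       = refl ∷ []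
perms-length (x ∷ xs) =
  All.concat⁺ (All.gmap⁺ (λ {σ} e → All.map (λ e′ → trans e′ (cong suc e)) (insertions-length x σ)) (perms-length xs))

first : ∀ {n} → Vec Status n → Status
first []      = done
first (s ∷ _) = s

enabledAfter : ∀ {n} → Status → Vec Status n → Fin n → Bool
enabledAfter l (s ∷ W) zero    = enabled s l (first W)
enabledAfter l (s ∷ W) (suc j) = enabledAfter s W j

pathExtensions : ∀ {n} → ℕ → Vec Status n → ℕ
pathExtensions     zero    W = 𝟙 (pendingCount W ≡ᵇ 0)
pathExtensions {n} (suc k) W = ∑[ i < n ] (if enabledAfter done W i then pathExtensions k (settle W i) else 0)

ordered : Status → ℕ → Status → ℕ → Bool
ordered remove a add    y = a <ᵇ y
ordered add    a remove y = y <ᵇ a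
ordered _      _ _      _ = true

-- σ lists, from left to right, the times at which the pending entries of W are settled,
-- the entry before W having status l and time a; each remove precedes its adjacent adds.
labelsFrom : ∀ {n} → Status → ℕ → Vec Status n → List ℕ → Bool
labelsFrom l a []       []      = true
labelsFrom l a []       (_ ∷ _) = false
labelsFrom l a (done ∷ W) σ     = labelsFrom done 0 W σ
labelsFrom l a (s ∷ W)  []      = false
labelsFrom l a (s ∷ W)  (y ∷ σ) = ordered l a s y ∧ labelsFrom s y W σ

Earlier : Status → ℕ → ℕ → Set
Earlier done _ _ = ⊤
Earlier _    a x = x < a

labelsFrom-[] : ∀ {n} l a (W : Vec Status n) → labelsFrom l a W [] ≡ (pendingCount W ≡ᵇ 0)
labelsFrom-[] l a []           = refl
labelsFrom-[] l a (remove ∷ W) = refl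
labelsFrom-[] l a (add    ∷ W) = refl
labelsFrom-[] l a (done   ∷ W) = labelsFrom-[] done 0 W

<ᵇ-true : ∀ {x y} → x < y → (x <ᵇ y) ≡ true
<ᵇ-true x<y = Equivalence.to T-≡ (<⇒<ᵇ x<y)

<ᵇ-false : ∀ {x y} → x < y → (y <ᵇ x) ≡ false
<ᵇ-false {zero}  {suc y} _       = refl
<ᵇ-false {suc x} {suc y} (s≤s p) = <ᵇ-false p

ordered-earliest : ∀ l a t x → Earlier l a x → pending t ≡ true → ordered l a t x ≡ enabled t l done
ordered-earliest remove a remove x x<a _ = refl
ordered-earliest add    a remove x x<a _ = <ᵇ-true x<a
ordered-earliest done   a remove x _   _ = refl
ordered-earliest remove a add    x x<a _ = <ᵇ-false x<a
ordered-earliest add    a add    x x<a _ = refl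
ordered-earliest done   a add    x _   _ = refl

enabled-then-ordered : ∀ t l s x y → pending t ≡ true → x < y → enabled t l done ∧ ordered t x s y ≡ enabled t l s
enabled-then-ordered remove l remove x y _ _   = refl
enabled-then-ordered remove l add    x y _ x<y = <ᵇ-true x<y
enabled-then-ordered remove l done   x y _ _   = refl
enabled-then-ordered add    l remove x y _ x<y =
  trans (cong ((not (isRemove l) ∧ true) ∧_) (<ᵇ-false x<y)) (trans (∧-zeroʳ _) (sym (∧-zeroʳ _)))
enabled-then-ordered add    l add    x y _ _   = ∧-identityʳ _
enabled-then-ordered add    l done   x y _ _   = ∧-identityʳ _

ordered-earliest-∷ : ∀ l a t x s y z → Earlier l a x → pending t ≡ true → x < y →
  ordered l a t x ∧ (ordered t x s y ∧ z) ≡ enabled t l s ∧ z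
ordered-earliest-∷ l a t x s y z e p x<y = begin
  ordered l a t x ∧ (ordered t x s y ∧ z)    ≡⟨ ∧-assoc (ordered l a t x) _ _ ⟨
  (ordered l a t x ∧ ordered t x s y) ∧ z    ≡⟨ cong (λ b → (b ∧ ordered t x s y) ∧ z) (ordered-earliest l a t x e p) ⟩
  (enabled t l done ∧ ordered t x s y) ∧ z   ≡⟨ cong (_∧ z) (enabled-then-ordered t l s x y p x<y) ⟩
  enabled t l s ∧ z                          ∎
  where open ≡-Reasoning

labelsFrom-earliest : ∀ {n} l a t x (W : Vec Status n) σ → Earlier l a x → pending t ≡ true → All (x <_) σ →
  ordered l a t x ∧ labelsFrom t x W σ ≡ enabled t l (first W) ∧ labelsFrom done 0 W σ
labelsFrom-earliest l a t x []           []      e p _ = cong (_∧ true) (ordered-earliest l a t x e p)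
labelsFrom-earliest l a t x []           (_ ∷ _) e p _ = cong (_∧ false) (ordered-earliest l a t x e p)
labelsFrom-earliest l a t x (done ∷ W)   σ       e p _ = cong (_∧ labelsFrom done 0 W σ) (ordered-earliest l a t x e p)
labelsFrom-earliest l a t x (remove ∷ W) []      e p _ = trans (∧-zeroʳ _) (sym (∧-zeroʳ _))
labelsFrom-earliest l a t x (add    ∷ W) []      e p _ = trans (∧-zeroʳ _) (sym (∧-zeroʳ _))
labelsFrom-earliest l a t x (remove ∷ W) (y ∷ σ) e p (x<y ∷ _) = ordered-earliest-∷ l a t x remove y _ e p x<y
labelsFrom-earliest l a t x (add    ∷ W) (y ∷ σ) e p (x<y ∷ _) = ordered-earliest-∷ l a t x add y _ e p x<y

labelsFrom-pending-∷ : ∀ {n} l a t (W : Vec Status n) y σ → pending t ≡ true →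
                       labelsFrom l a (t ∷ W) (y ∷ σ) ≡ ordered l a t y ∧ labelsFrom t y W σ
labelsFrom-pending-∷ l a remove W y σ _ = refl
labelsFrom-pending-∷ l a add    W y σ _ = refl

labelsFrom-pending-[] : ∀ {n} l a t (W : Vec Status n) → pending t ≡ true → labelsFrom l a (t ∷ W) [] ≡ false
labelsFrom-pending-[] l a remove W _ = refl
labelsFrom-pending-[] l a add    W _ = refl

count-false : ∀ {A : Set} (xs : List A) → count (λ _ → false) xs ≡ 0
count-false []       = refl
count-false (_ ∷ xs) = count-false xs

count-∧ˡ : ∀ {A : Set} c (P : A → Bool) xs → count (λ x → c ∧ P x) xs ≡ (if c then count P xs else 0)
count-∧ˡ true  P xs = refl
count-∧ˡ false P xs = count-false xs

∑-𝟙-∧-false : ∀ {n} (b : Fin n → Bool) → ∑[ i < n ] 𝟙 (b i ∧ false) ≡ 0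
∑-𝟙-∧-false {n} b = trans (sum-cong-≗ (λ i → cong 𝟙 (∧-zeroʳ (b i)))) (sum-replicate-zero n)

∑-𝟙-∧ : ∀ {n} (b d : Fin n → Bool) c → ∑[ i < n ] 𝟙 (b i ∧ (c ∧ d i)) ≡ (if c then ∑[ i < n ] 𝟙 (b i ∧ d i) else 0)
∑-𝟙-∧ b d true  = refl
∑-𝟙-∧ b d false = ∑-𝟙-∧-false b

count-insertions-[] : ∀ l a x σ → count (labelsFrom l a []) (insertions x σ) ≡ 0
count-insertions-[] l a x []      = refl
count-insertions-[] l a x (y ∷ σ) = trans (count-map (labelsFrom l a []) (y ∷_) (insertions x σ)) (count-false (insertions x σ))

-- Inserting the earliest time x into σ amounts to choosing the entry that is settled first.
count-insertions : ∀ {n} l a (W : Vec Status n) x σ → All (x <_) σ → Earlier l a x →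
  count (labelsFrom l a W) (insertions x σ) ≡ ∑[ i < n ] 𝟙 (enabledAfter l W i ∧ labelsFrom l a (settle W i) σ)
count-insertions-∷ : ∀ {n} l a t (W : Vec Status n) x σ → pending t ≡ true → All (x <_) σ → Earlier l a x →
  count (labelsFrom l a (t ∷ W)) (insertions x σ) ≡ ∑[ i < suc n ] 𝟙 (enabledAfter l (t ∷ W) i ∧ labelsFrom l a (settle (t ∷ W) i) σ)

count-insertions l a []           x σ x<σ _ = count-insertions-[] l a x σ
count-insertions l a (done ∷ W)   x σ x<σ _ = count-insertions done 0 W x σ x<σ tt
count-insertions l a (remove ∷ W) x σ x<σ e = count-insertions-∷ l a remove W x σ refl x<σ e
count-insertions l a (add    ∷ W) x σ x<σ e = count-insertions-∷ l a add    W x σ refl x<σ e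

count-insertions-∷ {n} l a t W x [] p [] e = cong₂ _+_
  (cong 𝟙 (trans (labelsFrom-pending-∷ l a t W x [] p) (labelsFrom-earliest l a t x W [] e p [])))
  (sym (trans (sum-cong-≗ (λ j → cong (λ b → 𝟙 (enabledAfter t W j ∧ b)) (labelsFrom-pending-[] l a t (settle W j) p)))
              (∑-𝟙-∧-false (enabledAfter t W))))
count-insertions-∷ {n} l a t W x (y ∷ σ) p (x<y ∷ x<σ) e = cong₂ _+_
  (cong 𝟙 (trans (labelsFrom-pending-∷ l a t W x (y ∷ σ) p) (labelsFrom-earliest l a t x W (y ∷ σ) e p (x<y ∷ x<σ))))
  (begin
    count (labelsFrom l a (t ∷ W)) (List.map (y ∷_) (insertions x σ))
      ≡⟨ count-map (labelsFrom l a (t ∷ W)) (y ∷_) (insertions x σ) ⟩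
    count (λ τ → labelsFrom l a (t ∷ W) (y ∷ τ)) (insertions x σ)
      ≡⟨ count-cong (λ τ → labelsFrom-pending-∷ l a t W y τ p) (insertions x σ) ⟩
    count (λ τ → ordered l a t y ∧ labelsFrom t y W τ) (insertions x σ)
      ≡⟨ count-∧ˡ (ordered l a t y) (labelsFrom t y W) (insertions x σ) ⟩
    (if ordered l a t y then count (labelsFrom t y W) (insertions x σ) else 0)
      ≡⟨ if-cong-then (ordered l a t y) (count-insertions t y W x σ x<σ (earlier-pending t p x<y)) ⟩
    (if ordered l a t y then ∑[ j < n ] 𝟙 (enabledAfter t W j ∧ labelsFrom t y (settle W j) σ) else 0)
      ≡⟨ ∑-𝟙-∧ (enabledAfter t W) (λ j → labelsFrom t y (settle W j) σ) (ordered l a t y) ⟨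
    ∑[ j < n ] 𝟙 (enabledAfter t W j ∧ (ordered l a t y ∧ labelsFrom t y (settle W j) σ))
      ≡⟨ sum-cong-≗ (λ j → cong (λ b → 𝟙 (enabledAfter t W j ∧ b)) (labelsFrom-pending-∷ l a t (settle W j) y σ p)) ⟨
    ∑[ j < n ] 𝟙 (enabledAfter t W j ∧ labelsFrom l a (t ∷ settle W j) (y ∷ σ))
  ∎)
  where
  open ≡-Reasoning
  earlier-pending : ∀ t → pending t ≡ true → x < y → Earlier t y x
  earlier-pending remove _ x<y = x<y
  earlier-pending add    _ x<y = x<y

count-labels-perms : ∀ L → AllPairs _<_ L → ∀ {n} (W : Vec Status n) →
                     count (labelsFrom done 0 W) (perms L) ≡ pathExtensions (List.length L) W
count-labels-perms []       _               W = trans (+-identityʳ _) (cong 𝟙 (labelsFrom-[] done 0 W))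
count-labels-perms (x ∷ xs) (x<xs ∷ sorted) {n} W = begin
  count (labelsFrom done 0 W) (List.concatMap (insertions x) (perms xs))
    ≡⟨ count-concatMap (labelsFrom done 0 W) (insertions x) (perms xs) ⟩
  sumList (List.map (λ σ → count (labelsFrom done 0 W) (insertions x σ)) (perms xs))
    ≡⟨ cong sumList (map-cong-local (All.map (λ x<σ → count-insertions done 0 W x _ x<σ tt) (perms-All x<xs))) ⟩
  sumList (List.map (λ σ → ∑[ i < n ] 𝟙 (enabledAfter done W i ∧ labelsFrom done 0 (settle W i) σ)) (perms xs))
    ≡⟨ sumList-∑-comm (λ σ i → 𝟙 (enabledAfter done W i ∧ labelsFrom done 0 (settle W i) σ)) (perms xs) ⟩
  ∑[ i < n ] count (λ σ → enabledAfter done W i ∧ labelsFrom done 0 (settle W i) σ) (perms xs)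
    ≡⟨ sum-cong-≗ (λ i → count-∧ˡ (enabledAfter done W i) (labelsFrom done 0 (settle W i)) (perms xs)) ⟩
  ∑[ i < n ] (if enabledAfter done W i then count (labelsFrom done 0 (settle W i)) (perms xs) else 0)
    ≡⟨ sum-cong-≗ (λ i → if-cong-then (enabledAfter done W i) (count-labels-perms xs sorted (settle W i))) ⟩
  pathExtensions (suc (List.length xs)) W
  ∎
  where open ≡-Reasoning

dual : Status → Status
dual remove = add
dual add    = remove
dual done   = done

zigzag : Status → (m : ℕ) → Vec Status (suc m)
zigzag s zero    = done ∷ []
zigzag s (suc m) = s ∷ zigzag (dual s) m

labelsFrom-zigzag-remove : ∀ m x r → List.length r ≡ m → labelsFrom add x (zigzag remove m) r ≡ altFrom true (x ∷ r)
labelsFrom-zigzag-add    : ∀ m x r → List.length r ≡ m → labelsFrom remove x (zigzag add m) r ≡ altFrom false (x ∷ r)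
labelsFrom-zigzag-remove zero    x []      _ = refl
labelsFrom-zigzag-remove (suc m) x (y ∷ r) e = cong ((y <ᵇ x) ∧_) (labelsFrom-zigzag-add m y r (suc-injective e))
labelsFrom-zigzag-add    zero    x []      _ = refl
labelsFrom-zigzag-add    (suc m) x (y ∷ r) e = cong ((x <ᵇ y) ∧_) (labelsFrom-zigzag-remove m y r (suc-injective e))

labels-zigzag : ∀ m σ → List.length σ ≡ m → labelsFrom done 0 (zigzag add m) σ ≡ alternating σ
labels-zigzag zero    []      _ = refl
labels-zigzag (suc m) (x ∷ r) e = labelsFrom-zigzag-remove m x r (suc-injective e)

length-oneTo : ∀ m → List.length (oneTo m) ≡ m
length-oneTo m = trans (length-map suc (List.upTo m)) (length-upTo m)

oneTo-increasing : ∀ m → AllPairs _<_ (oneTo m)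
oneTo-increasing m = AllPairs.map⁺ (AllPairs.applyUpTo⁺₁ (λ i → i) m (λ i<j _ → s≤s i<j))

Euler≡pathExtensions : ∀ m → Euler m ≡ pathExtensions m (zigzag add m)
Euler≡pathExtensions m = begin
  Euler m                                                        ≡⟨ length-filter alternating (perms (oneTo m)) ⟩
  count alternating (perms (oneTo m))                            ≡⟨ count-cong-local alternating≡labels ⟨
  count (labelsFrom done 0 (zigzag add m)) (perms (oneTo m))     ≡⟨ count-labels-perms (oneTo m) (oneTo-increasing m) (zigzag add m) ⟩
  pathExtensions (List.length (oneTo m)) (zigzag add m)          ≡⟨ cong (λ k → pathExtensions k (zigzag add m)) (length-oneTo m) ⟩
  pathExtensions m (zigzag add m)                                ∎
  where
  open ≡-Reasoning
  alternating≡labels : All (λ σ → labelsFrom done 0 (zigzag add m) σ ≡ alternating σ) (perms (oneTo m))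
  alternating≡labels = All.map (λ e → labels-zigzag m _ (trans e (length-oneTo m))) (perms-length (oneTo m))

-- From the path to the cycle

leftOf : ∀ {n} → Status → Vec Status n → Fin n → Status
leftOf l (s ∷ W) zero    = l
leftOf l (s ∷ W) (suc j) = leftOf s W j

leftOf-suc : ∀ {n} l (W : Vec Status (suc n)) (j : Fin n) → leftOf l W (suc j) ≡ lookup W (inject₁ j)
leftOf-suc l (s ∷ t ∷ W) zero    = refl
leftOf-suc l (s ∷ W)     (suc j) = leftOf-suc s W j

leftOf-prev : ∀ {m} (W : Vec Status (suc m)) → lookup W (fromℕ m) ≡ done →
              ∀ (j : Fin m) → leftOf done W (inject₁ j) ≡ lookup W (prev (inject₁ j))
leftOf-prev (s ∷ W) last zero    = sym last
leftOf-prev (s ∷ W) last (suc j) = leftOf-suc done (s ∷ W) (inject₁ j)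

enabledAfter-inject₁ : ∀ {m} l (W : Vec Status (suc m)) (j : Fin m) →
  enabledAfter l W (inject₁ j) ≡ enabled (lookup W (inject₁ j)) (leftOf l W (inject₁ j)) (lookup W (suc j))
enabledAfter-inject₁ l (s ∷ t ∷ W) zero    = refl
enabledAfter-inject₁ l (s ∷ W)     (suc j) = enabledAfter-inject₁ s W j

enabledAfter-fromℕ : ∀ {m} l (W : Vec Status (suc m)) → lookup W (fromℕ m) ≡ done → enabledAfter l W (fromℕ m) ≡ false
enabledAfter-fromℕ l (s ∷ [])    last = cong (λ s → enabled s l done) last
enabledAfter-fromℕ l (s ∷ t ∷ W) last = enabledAfter-fromℕ s (t ∷ W) last

enabledAt≡enabledAfter : ∀ {m} (W : Vec Status (suc m)) → lookup W (fromℕ m) ≡ done → ∀ i → enabledAt W i ≡ enabledAfter done W i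
enabledAt≡enabledAfter {m} W last i with view i
... | ‵fromℕ = trans (cong (λ s → enabled s (lookup W (prev (fromℕ m))) (lookup W zero)) last) (sym (enabledAfter-fromℕ done W last))
... | ‵inj₁ {i = j} _ =
  trans (cong (λ l → enabled (lookup W (inject₁ j)) l (lookup W (suc j))) (sym (leftOf-prev W last j))) (sym (enabledAfter-inject₁ done W j))

settle-last : ∀ {m} (W : Vec Status (suc m)) i → lookup W (fromℕ m) ≡ done → lookup (settle W i) (fromℕ m) ≡ done
settle-last {m} W i last with fromℕ m ≟ i
... | yes refl = lookup-settle W i
... | no ≢i    = trans (lookup-settle-≢ W ≢i) last

extensions≡pathExtensions : ∀ k {m} (W : Vec Status (suc m)) → lookup W (fromℕ m) ≡ done → extensions k W ≡ pathExtensions k W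
extensions≡pathExtensions zero    W last = refl
extensions≡pathExtensions (suc k) W last = sum-cong-≗ λ i →
  cong₂ (λ b x → if b then x else 0) (enabledAt≡enabledAfter W last i) (extensions≡pathExtensions k (settle W i) (settle-last W i last))

zigzag-last : ∀ s m → lookup (zigzag s m) (fromℕ m) ≡ done
zigzag-last s zero    = refl
zigzag-last s (suc m) = zigzag-last (dual s) m

extensions-zigzag : ∀ m → extensions m (zigzag add m) ≡ Euler m
extensions-zigzag m = trans (extensions≡pathExtensions m (zigzag add m) (zigzag-last add m)) (sym (Euler≡pathExtensions m))

relabel : ∀ {n} → Permutation′ n → Vec Status n → Vec Status n
relabel π W = tabulate (λ i → lookup W (π ⟨$⟩ʳ i))

lookup-relabel : ∀ {n} (π : Permutation′ n) (W : Vec Status n) i → lookup (relabel π W) i ≡ lookup W (π ⟨$⟩ʳ i)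
lookup-relabel π W i = lookup∘tabulate (λ k → lookup W (π ⟨$⟩ʳ k)) i

enabled-comm : ∀ s l r → enabled s l r ≡ enabled s r l
enabled-comm remove l r = refl
enabled-comm add    l r = ∧-comm (not (isRemove l)) _
enabled-comm done   l r = refl

enabledAt-relabel : ∀ {n} (π : Permutation′ n) → IsSymmetry π → ∀ W i → enabledAt (relabel π W) i ≡ enabledAt W (π ⟨$⟩ʳ i)
enabledAt-relabel π symmetric W i
  rewrite lookup-relabel π W i | lookup-relabel π W (prev i) | lookup-relabel π W (next i) with symmetric
... | inj₁ rot rewrite rotation-prev π rot i | rot i = refl
... | inj₂ ref rewrite reflection-prev π ref i | ref i = enabled-comm (lookup W (π ⟨$⟩ʳ i)) _ _

settle-relabel : ∀ {n} (π : Permutation′ n) W i → settle (relabel π W) i ≡ relabel π (settle W (π ⟨$⟩ʳ i))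
settle-relabel π W i = vec-ext entry
  where
  entry : ∀ j → lookup (settle (relabel π W) i) j ≡ lookup (relabel π (settle W (π ⟨$⟩ʳ i))) j
  entry j with j ≟ i
  ... | yes refl = trans (lookup-settle (relabel π W) j)
                         (sym (trans (lookup-relabel π (settle W (π ⟨$⟩ʳ j)) j) (lookup-settle W (π ⟨$⟩ʳ j))))
  ... | no j≢i = begin
    lookup (settle (relabel π W) i) j            ≡⟨ lookup-settle-≢ (relabel π W) j≢i ⟩
    lookup (relabel π W) j                       ≡⟨ lookup-relabel π W j ⟩
    lookup W (π ⟨$⟩ʳ j)                          ≡⟨ lookup-settle-≢ W (j≢i ∘ Injection.injective (↔⇒↣ π)) ⟨
    lookup (settle W (π ⟨$⟩ʳ i)) (π ⟨$⟩ʳ j)      ≡⟨ lookup-relabel π (settle W (π ⟨$⟩ʳ i)) j ⟨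
    lookup (relabel π (settle W (π ⟨$⟩ʳ i))) j   ∎
    where open ≡-Reasoning

pendingCount≡∑ : ∀ {n} (W : Vec Status n) → pendingCount W ≡ ∑[ i < n ] 𝟙 (pending (lookup W i))
pendingCount≡∑ []      = refl
pendingCount≡∑ (s ∷ W) = cong (𝟙 (pending s) +_) (pendingCount≡∑ W)

pendingCount-relabel : ∀ {n} (π : Permutation′ n) W → pendingCount (relabel π W) ≡ pendingCount W
pendingCount-relabel {n} π W = begin
  pendingCount (relabel π W)                            ≡⟨ pendingCount≡∑ (relabel π W) ⟩
  ∑[ i < n ] 𝟙 (pending (lookup (relabel π W) i))       ≡⟨ sum-cong-≗ (λ i → cong (λ s → 𝟙 (pending s)) (lookup-relabel π W i)) ⟩
  ∑[ i < n ] 𝟙 (pending (lookup W (π ⟨$⟩ʳ i)))          ≡⟨ ∑-permute (λ i → 𝟙 (pending (lookup W i))) π ⟨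
  ∑[ i < n ] 𝟙 (pending (lookup W i))                   ≡⟨ pendingCount≡∑ W ⟨
  pendingCount W                                        ∎
  where open ≡-Reasoning

extensions-relabel : ∀ {n} (π : Permutation′ n) → IsSymmetry π → ∀ k W → extensions k (relabel π W) ≡ extensions k W
extensions-relabel π _ zero    W = cong (λ p → 𝟙 (p ≡ᵇ 0)) (pendingCount-relabel π W)
extensions-relabel {n} π symmetric (suc k) W = begin
  ∑[ i < n ] (if enabledAt (relabel π W) i then extensions k (settle (relabel π W) i) else 0)   ≡⟨ sum-cong-≗ termwise ⟩
  ∑[ i < n ] term (π ⟨$⟩ʳ i)                                                                     ≡⟨ ∑-permute term π ⟨
  ∑[ i < n ] term i                                                                              ∎
  where
  open ≡-Reasoning
  term : Fin n → ℕ
  term i = if enabledAt W i then extensions k (settle W i) else 0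
  termwise : ∀ i → (if enabledAt (relabel π W) i then extensions k (settle (relabel π W) i) else 0) ≡ term (π ⟨$⟩ʳ i)
  termwise i = cong₂ (λ b x → if b then x else 0) (enabledAt-relabel π symmetric W i)
    (trans (cong (extensions k) (settle-relabel π W i)) (extensions-relabel π symmetric k (settle W (π ⟨$⟩ʳ i))))

-- Alternating cyclic words

clash : Status → Status → Bool
clash remove remove = true
clash add    add    = true
clash _      _      = false

NoClash : ∀ {n} → Vec Status n → Set
NoClash W = ∀ i → clash (lookup W i) (lookup W (next i)) ≡ false

clash-comm : ∀ s t → clash s t ≡ clash t s
clash-comm remove remove = refl
clash-comm remove add    = refl
clash-comm remove done   = refl
clash-comm add    remove = refl
clash-comm add    add    = refl
clash-comm add    done   = refl
clash-comm done   remove = refl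
clash-comm done   add    = refl
clash-comm done   done   = refl

noClash-relabel : ∀ {n} (π : Permutation′ n) → IsSymmetry π → ∀ W → NoClash W → NoClash (relabel π W)
noClash-relabel π symmetric W noClash i rewrite lookup-relabel π W i | lookup-relabel π W (next i) with symmetric
... | inj₁ rot rewrite rot i = noClash (π ⟨$⟩ʳ i)
... | inj₂ ref rewrite ref i = begin
  clash (lookup W x) (lookup W (prev x))             ≡⟨ clash-comm (lookup W x) _ ⟩
  clash (lookup W (prev x)) (lookup W x)             ≡⟨ cong (λ k → clash (lookup W (prev x)) (lookup W k)) (next-prev x) ⟨
  clash (lookup W (prev x)) (lookup W (next (prev x))) ≡⟨ noClash (prev x) ⟩
  false                                              ∎
  where
  open ≡-Reasoning
  x = π ⟨$⟩ʳ i

no-clash-dual : ∀ s t → pending s ≡ true → pending t ≡ true → clash s t ≡ false → t ≡ dual s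
no-clash-dual remove add    _ _ _ = refl
no-clash-dual add    remove _ _ _ = refl

𝟙≤1 : ∀ b → 𝟙 b ≤ 1
𝟙≤1 true  = ≤-refl
𝟙≤1 false = z≤n

pendingCount-≤ : ∀ {n} (W : Vec Status n) → pendingCount W ≤ n
pendingCount-≤ []      = z≤n
pendingCount-≤ (s ∷ W) = +-mono-≤ (𝟙≤1 (pending s)) (pendingCount-≤ W)

pendingCount-last-≤ : ∀ {m} (W : Vec Status (suc m)) → lookup W (fromℕ m) ≡ done → pendingCount W ≤ m
pendingCount-last-≤ (s ∷ [])    last rewrite last = z≤n
pendingCount-last-≤ (s ∷ t ∷ W) last = +-mono-≤ (𝟙≤1 (pending s)) (pendingCount-last-≤ (t ∷ W) last)

pendingCount-∷-suc : ∀ {n} s (W : Vec Status n) {m} → pendingCount (s ∷ W) ≡ suc m → pendingCount W ≤ m →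
                      pending s ≡ true × pendingCount W ≡ m
pendingCount-∷-suc s W p W≤m with pending s
... | true  = refl , suc-injective p
... | false with () ← <-irrefl refl (≤-trans (s≤s W≤m) (≤-reflexive (sym p)))

noClash-path : ∀ {m} (W : Vec Status (suc m)) → NoClash W →
               ∀ (j : Fin m) → clash (lookup W (inject₁ j)) (lookup W (suc j)) ≡ false
noClash-path W noClash j =
  subst (λ k → clash (lookup W (inject₁ j)) (lookup W k) ≡ false) (next-inject₁ j) (noClash (inject₁ j))

path⇒zigzag : ∀ {m} (W : Vec Status (suc m)) → lookup W (fromℕ m) ≡ done → pendingCount W ≡ m →
               (∀ (j : Fin m) → clash (lookup W (inject₁ j)) (lookup W (suc j)) ≡ false) → W ≡ zigzag (first W) m
path⇒zigzag {zero}  (s ∷ [])    last _ _ = cong (_∷ []) last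
path⇒zigzag {suc m} (s ∷ W)     last p noClash with pendingCount-∷-suc s W p (pendingCount-last-≤ W last)
... | pₛ , pW = cong (s ∷_) (trans (path⇒zigzag W last pW (λ j → noClash (suc j))) (continues m W last pW (noClash zero)))
  where
  continues : ∀ m (W : Vec Status (suc m)) → lookup W (fromℕ m) ≡ done → pendingCount W ≡ m → clash s (lookup W zero) ≡ false →
              zigzag (first W) m ≡ zigzag (dual s) m
  continues zero    W       _    _  _ = refl
  continues (suc m) (t ∷ W) last pW c =
    cong (λ t → zigzag t (suc m)) (no-clash-dual s t pₛ (proj₁ (pendingCount-∷-suc t W pW (pendingCount-last-≤ W last))) c)

extensions-alternating : ∀ {m} (W : Vec Status (suc m)) → NoClash W → pendingCount W ≡ m →
  ∀ j k → k ≡ next j ⊎ k ≡ prev j → lookup W j ≡ done → lookup W k ≡ add → extensions m W ≡ Euler m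
extensions-alternating {m} W noClash p j k adjacent Wⱼ Wₖ with symmetry-onto j k adjacent
... | π , symmetric , π-fromℕ , π-zero = begin
  extensions m W                ≡⟨ extensions-relabel π symmetric m W ⟨
  extensions m (relabel π W)    ≡⟨ cong (extensions m) shape ⟩
  extensions m (zigzag add m)   ≡⟨ extensions-zigzag m ⟩
  Euler m                       ∎
  where
  open ≡-Reasoning
  last-done : lookup (relabel π W) (fromℕ m) ≡ done
  last-done = trans (lookup-relabel π W (fromℕ m)) (trans (cong (lookup W) π-fromℕ) Wⱼ)
  shape : relabel π W ≡ zigzag add m
  shape = trans (path⇒zigzag (relabel π W) last-done (trans (pendingCount-relabel π W) p)
                             (noClash-path (relabel π W) (noClash-relabel π symmetric W noClash)))
                (cong (λ s → zigzag s m) (trans (cong (lookup W) π-zero) Wₖ))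

clash-statuses : ∀ a b c d → a ∧ c ≡ false → b ∧ d ≡ false → clash (status a b) (status c d) ≡ false
clash-statuses true  true  c     d     _  _  = refl
clash-statuses false false c     d     _  _  = refl
clash-statuses true  false true  _     () _
clash-statuses true  false false true  _  _  = refl
clash-statuses true  false false false _  _  = refl
clash-statuses false true  _     true  _  ()
clash-statuses false true  true  false _  _  = refl
clash-statuses false true  false false _  _  = refl

noClash-statuses : ∀ {n} (u v : Vec Bool n) → Independent u → Independent v → NoClash (statuses u v)
noClash-statuses u v indᵤ indᵥ i rewrite lookup-statuses u v i | lookup-statuses u v (next i) =
  clash-statuses (lookup u i) (lookup v i) (lookup u (next i)) (lookup v (next i)) (indᵤ i) (indᵥ i)

clash-done : ∀ s → clash done s ≡ false × clash s done ≡ false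
clash-done remove = refl , refl
clash-done add    = refl , refl
clash-done done   = refl , refl

noClash-settle : ∀ {n} (W : Vec Status n) i → NoClash W → NoClash (settle W i)
noClash-settle W i noClash j with j ≟ i
... | yes refl rewrite lookup-settle W j = proj₁ (clash-done (lookup (settle W j) (next j)))
... | no j≢i with next j ≟ i
...   | yes refl rewrite lookup-settle W (next j) = proj₂ (clash-done (lookup (settle W (next j)) j))
...   | no nj≢i rewrite lookup-settle-≢ W j≢i | lookup-settle-≢ W nj≢i = noClash j

all-pending : ∀ {n} (W : Vec Status n) → pendingCount W ≡ n → ∀ i → pending (lookup W i) ≡ true
all-pending (s ∷ W) p i with pendingCount-∷-suc s W p (pendingCount-≤ W)
all-pending (s ∷ W) p zero    | pₛ , _  = pₛ
all-pending (s ∷ W) p (suc i) | _  , pW = all-pending W pW i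

done-exists : ∀ {n} (W : Vec Status n) → pendingCount W < n → Σ (Fin n) λ j → lookup W j ≡ done
done-exists (done   ∷ W) _       = zero , refl
done-exists (remove ∷ W) (s≤s p) with done-exists W p
... | j , Wⱼ = suc j , Wⱼ
done-exists (add    ∷ W) (s≤s p) with done-exists W p
... | j , Wⱼ = suc j , Wⱼ

next-dual : ∀ {n} (W : Vec Status n) → NoClash W → (∀ i → pending (lookup W i) ≡ true) →
            ∀ i → lookup W (next i) ≡ dual (lookup W i)
next-dual W noClash full i = no-clash-dual (lookup W i) _ (full i) (full (next i)) (noClash i)

isAdd : Status → Bool
isAdd add = true
isAdd _   = false

removeCount : ∀ {n} → Vec Status n → ℕ
removeCount {n} W = ∑[ i < n ] 𝟙 (isRemove (lookup W i))

∑-1 : ∀ n → ∑[ i < n ] 1 ≡ n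
∑-1 zero    = refl
∑-1 (suc n) = cong suc (∑-1 n)

isRemove-dual : ∀ s → isRemove (dual s) ≡ isAdd s
isRemove-dual remove = refl
isRemove-dual add    = refl
isRemove-dual done   = refl

remove+add : ∀ s → pending s ≡ true → 𝟙 (isRemove s) + 𝟙 (isAdd s) ≡ 1
remove+add remove _ = refl
remove+add add    _ = refl

-- Along the cycle removes and adds alternate, so each remove is followed by an add.
double-removeCount : ∀ {n} (W : Vec Status n) → NoClash W → (∀ i → pending (lookup W i) ≡ true) → 2 * removeCount W ≡ n
double-removeCount {n} W noClash full = begin
  2 * removeCount W                                                    ≡⟨ cong (removeCount W +_) (+-identityʳ (removeCount W)) ⟩
  removeCount W + removeCount W                                        ≡⟨ cong (removeCount W +_) removes≡adds ⟩
  removeCount W + ∑[ i < n ] 𝟙 (isAdd (lookup W i))                    ≡⟨ ∑-distrib-+ (λ i → 𝟙 (isRemove (lookup W i))) _ ⟨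
  ∑[ i < n ] (𝟙 (isRemove (lookup W i)) + 𝟙 (isAdd (lookup W i)))     ≡⟨ sum-cong-≗ (λ i → remove+add (lookup W i) (full i)) ⟩
  ∑[ i < n ] 1                                                         ≡⟨ ∑-1 n ⟩
  n                                                                    ∎
  where
  open ≡-Reasoning
  removes≡adds : removeCount W ≡ ∑[ i < n ] 𝟙 (isAdd (lookup W i))
  removes≡adds = begin
    removeCount W                                   ≡⟨ ∑-permute (λ i → 𝟙 (isRemove (lookup W i))) rotation ⟩
    ∑[ i < n ] 𝟙 (isRemove (lookup W (next i)))     ≡⟨ sum-cong-≗ (λ i → cong (λ s → 𝟙 (isRemove s)) (next-dual W noClash full i)) ⟩
    ∑[ i < n ] 𝟙 (isRemove (dual (lookup W i)))     ≡⟨ sum-cong-≗ (λ i → cong 𝟙 (isRemove-dual (lookup W i))) ⟩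
    ∑[ i < n ] 𝟙 (isAdd (lookup W i))               ∎

extensions-full : ∀ {N} (W : Vec Status (suc (suc N))) → NoClash W → pendingCount W ≡ suc (suc N) →
                  extensions (suc (suc N)) W ≡ removeCount W * Euler (suc N)
extensions-full {N} W noClash p = begin
  extensions (suc (suc N)) W                                  ≡⟨ sum-cong-≗ term ⟩
  ∑[ i < suc (suc N) ] (𝟙 (isRemove (lookup W i)) * Euler (suc N))   ≡⟨ *-distribʳ-sum (Euler (suc N)) (λ i → 𝟙 (isRemove (lookup W i))) ⟨
  removeCount W * Euler (suc N)                               ∎
  where
  open ≡-Reasoning
  full : ∀ i → pending (lookup W i) ≡ true
  full = all-pending W p
  term : ∀ i → (if enabledAt W i then extensions (suc N) (settle W i) else 0) ≡ 𝟙 (isRemove (lookup W i)) * Euler (suc N)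
  term i with lookup W i in Wᵢ
  ... | remove = trans (extensions-alternating (settle W i) (noClash-settle W i noClash) settled-count
                                               i (next i) (inj₁ refl) (lookup-settle W i) next-add)
                       (sym (+-identityʳ _))
    where
    settled-count : pendingCount (settle W i) ≡ suc N
    settled-count = suc-injective (trans (sym (pendingCount-settle-pending W i (full i))) p)
    next-add : lookup (settle W i) (next i) ≡ add
    next-add = trans (lookup-settle-≢ W (next≢ i)) (trans (next-dual W noClash full i) (cong dual Wᵢ))
  ... | add = trans (cong (λ s → if not (isRemove (lookup W (prev i))) ∧ not (isRemove s) then extensions (suc N) (settle W i) else 0)
                          (trans (next-dual W noClash full i) (cong dual Wᵢ)))
                    (cong (λ b → if b then extensions (suc N) (settle W i) else 0) (∧-zeroʳ _))
  ... | done with () ← trans (sym (cong pending Wᵢ)) (full i)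

double : ℕ → ℕ
double zero    = zero
double (suc k) = suc (suc (double k))

dual-involutive : ∀ s → dual (dual s) ≡ s
dual-involutive remove = refl
dual-involutive add    = refl
dual-involutive done   = refl

zigzag-penultimate : ∀ s k → lookup (zigzag s (double (suc k))) (prev (fromℕ (double (suc k)))) ≡ dual s
zigzag-penultimate s zero    = refl
zigzag-penultimate s (suc k) = trans (zigzag-penultimate (dual (dual s)) k) (cong dual (dual-involutive s))

zigzag-ends : ∀ {k} (W : Vec Status (suc (double (suc k)))) → NoClash W → lookup W (fromℕ (double (suc k))) ≡ done →
              pendingCount W ≡ double (suc k) → lookup W zero ≡ add ⊎ lookup W (prev (fromℕ (double (suc k)))) ≡ add
zigzag-ends {k} (s ∷ W) noClash last p with pendingCount-∷-suc s W p (pendingCount-last-≤ W last)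
... | pₛ , _ with s | path⇒zigzag (s ∷ W) last p (noClash-path (s ∷ W) noClash)
... | remove | shape =
  inj₂ (trans (cong (λ W′ → lookup W′ (prev (fromℕ (double (suc k))))) shape) (zigzag-penultimate remove k))
... | add    | _     = inj₁ refl

-- Between the two sides of the done entry lie an even number of alternating entries.
done-neighbour-add : ∀ {k} (W : Vec Status (suc (double (suc k)))) → NoClash W → pendingCount W ≡ double (suc k) →
                     ∀ j → lookup W j ≡ done → Σ (Fin (suc (double (suc k)))) λ i → (i ≡ next j ⊎ i ≡ prev j) × lookup W i ≡ add
done-neighbour-add {k} W noClash p j Wⱼ = neighbour (rotation-onto j)
  where
  N = double (suc k)
  neighbour : Σ (Permutation′ (suc N)) (λ π → IsRotation π × π ⟨$⟩ʳ fromℕ N ≡ j) →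
              Σ (Fin (suc N)) λ i → (i ≡ next j ⊎ i ≡ prev j) × lookup W i ≡ add
  neighbour (π , rot , π-fromℕ) = [ after-add , before-add ]′
    (zigzag-ends (relabel π W) (noClash-relabel π (inj₁ rot) W noClash) last-done (trans (pendingCount-relabel π W) p))
    where
    last-done : lookup (relabel π W) (fromℕ N) ≡ done
    last-done = trans (lookup-relabel π W (fromℕ N)) (trans (cong (lookup W) π-fromℕ) Wⱼ)
    after : π ⟨$⟩ʳ zero ≡ next j
    after = trans (cong (π ⟨$⟩ʳ_) (sym (next-fromℕ N))) (trans (rot (fromℕ N)) (cong next π-fromℕ))
    before : π ⟨$⟩ʳ prev (fromℕ N) ≡ prev j
    before = trans (rotation-prev π rot (fromℕ N)) (cong prev π-fromℕ)
    after-add : lookup (relabel π W) zero ≡ add → Σ (Fin (suc N)) λ i → (i ≡ next j ⊎ i ≡ prev j) × lookup W i ≡ add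
    after-add first-add = next j , inj₁ refl , trans (cong (lookup W) (sym after)) (trans (sym (lookup-relabel π W zero)) first-add)
    before-add : lookup (relabel π W) (prev (fromℕ N)) ≡ add → Σ (Fin (suc N)) λ i → (i ≡ next j ⊎ i ≡ prev j) × lookup W i ≡ add
    before-add penultimate-add =
      prev j , inj₂ refl , trans (cong (lookup W) (sym before)) (trans (sym (lookup-relabel π W (prev (fromℕ N)))) penultimate-add)

extensions-odd : ∀ {k} (W : Vec Status (suc (double (suc k)))) → NoClash W → pendingCount W ≡ double (suc k) →
                 extensions (double (suc k)) W ≡ Euler (double (suc k))
extensions-odd {k} W noClash p = extensions-alternating W noClash p j i adjacent Wⱼ Wᵢ
  where
  done-entry = done-exists W (≤-reflexive (cong suc p))
  j = proj₁ done-entry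
  Wⱼ = proj₂ done-entry
  neighbour = done-neighbour-add W noClash p j Wⱼ
  i = proj₁ neighbour
  adjacent = proj₁ (proj₂ neighbour)
  Wᵢ = proj₂ (proj₂ neighbour)

-- The diameter

alternatingBits : Bool → (k : ℕ) → Vec Bool k
alternatingBits b zero    = []
alternatingBits b (suc k) = b ∷ alternatingBits (not b) k

noConsec-alternatingBits : ∀ b k → noConsec (alternatingBits b k) ≡ true
noConsec-alternatingBits b zero          = refl
noConsec-alternatingBits b (suc zero)    = refl
noConsec-alternatingBits b (suc (suc k)) = cong₂ _∧_ (cong not (∧-inverseʳ b)) (noConsec-alternatingBits (not b) (suc k))

last-alternatingBits : ∀ b k → last (alternatingBits b (double (suc k))) ≡ not b
last-alternatingBits b zero    = refl
last-alternatingBits b (suc k) = trans (last-alternatingBits (not (not b)) k) (cong not (not-involutive b))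

alternatingBits-independent : ∀ b k → Independent (alternatingBits b (double (suc k)))
alternatingBits-independent b k = isLucas⇒independent _ (cong₂ _∧_ (noConsec-alternatingBits b (double (suc k)))
  (cong not (trans (cong (b ∧_) (last-alternatingBits b k)) (∧-inverseʳ b))))

false∷alternatingBits-independent : ∀ b k → Independent (false ∷ alternatingBits b (double k))
false∷alternatingBits-independent b zero    = isLucas⇒independent (false ∷ []) refl
false∷alternatingBits-independent b (suc k) = isLucas⇒independent _ (cong (_∧ true) (noConsec-alternatingBits b (double (suc k))))

pendingCount-alternatingBits : ∀ b k → pendingCount (statuses (alternatingBits b k) (alternatingBits (not b) k)) ≡ k
pendingCount-alternatingBits b     zero    = refl
pendingCount-alternatingBits true  (suc k) = cong suc (pendingCount-alternatingBits false k)
pendingCount-alternatingBits false (suc k) = cong suc (pendingCount-alternatingBits true k)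

diameter-≥ : ∀ {n D} → IsDiam n D → (u v : Vec Bool n) → Independent u → Independent v → pendingCount (statuses u v) ≤ D
diameter-≥ (_ , bounded) u v indᵤ indᵥ = bounded u v _
  (walk-of-pendingCount _ u v indᵤ indᵥ refl , λ j j<p walk → <⇒≱ j<p (walk-pendingCount-≤ walk))

diameter-≥-even : ∀ {k D} → IsDiam (double (suc k)) D → double (suc k) ≤ D
diameter-≥-even {k} {D} diam = subst (_≤ D) (pendingCount-alternatingBits true (double (suc k)))
  (diameter-≥ diam _ _ (alternatingBits-independent true k) (alternatingBits-independent false k))

diameter-≥-odd : ∀ {k D} → IsDiam (suc (double (suc k))) D → double (suc k) ≤ D
diameter-≥-odd {k} {D} diam = subst (_≤ D) (pendingCount-alternatingBits true (double (suc k)))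
  (diameter-≥ diam _ _ (false∷alternatingBits-independent true (suc k)) (false∷alternatingBits-independent false (suc k)))

2*≡double : ∀ m → 2 * m ≡ double m
2*≡double zero    = refl
2*≡double (suc m) = cong suc (trans (+-suc m (m + 0)) (cong suc (2*≡double m)))

numWalks-diameter-even : ∀ {n} k → n ≡ double (suc k) → (u v : Vec Bool n) → Lucas u → Lucas v →
                         ∀ D → IsDiam n D → IsDist u v D → numWalks D u v ≡ suc k * Euler (n ∸ 1)
numWalks-diameter-even {n} k refl u v lᵤ lᵥ D diam dist = begin
  numWalks D u v                           ≡⟨ numWalks≡extensions D u v indᵤ indᵥ (≤-reflexive D≡p) ⟩
  extensions D W                           ≡⟨ cong (λ d → extensions d W) (trans D≡p p≡n) ⟩
  extensions n W                           ≡⟨ extensions-full W noClash p≡n ⟩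
  removeCount W * Euler (n ∸ 1)            ≡⟨ cong (_* Euler (n ∸ 1)) half ⟩
  suc k * Euler (n ∸ 1)                    ∎
  where
  open ≡-Reasoning
  indᵤ = lucas⇒independent u lᵤ
  indᵥ = lucas⇒independent v lᵥ
  W = statuses u v
  noClash = noClash-statuses u v indᵤ indᵥ
  D≡p : D ≡ pendingCount W
  D≡p = distance≡pendingCount u v indᵤ indᵥ dist
  p≡n : pendingCount W ≡ n
  p≡n = ≤-antisym (pendingCount-≤ W) (≤-trans (diameter-≥-even diam) (≤-reflexive D≡p))
  half : removeCount W ≡ suc k
  half = *-cancelˡ-≡ _ _ 2 (trans (double-removeCount W noClash (all-pending W p≡n)) (sym (2*≡double (suc k))))

numWalks-diameter-odd : ∀ {n} k → n ≡ suc (double (suc k)) → (u v : Vec Bool n) → Lucas u → Lucas v →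
                        ∀ D → IsDiam n D → IsDist u v D → numWalks D u v ≡ Euler (n ∸ 1)
numWalks-diameter-odd {n} k refl u v lᵤ lᵥ D diam dist = begin
  numWalks D u v                           ≡⟨ numWalks≡extensions D u v indᵤ indᵥ (≤-reflexive D≡p) ⟩
  extensions D W                           ≡⟨ cong (λ d → extensions d W) (trans D≡p p≡n-1) ⟩
  extensions (n ∸ 1) W                     ≡⟨ extensions-odd W noClash p≡n-1 ⟩
  Euler (n ∸ 1)                            ∎
  where
  open ≡-Reasoning
  indᵤ = lucas⇒independent u lᵤ
  indᵥ = lucas⇒independent v lᵥ
  W = statuses u v
  noClash = noClash-statuses u v indᵤ indᵥ
  D≡p : D ≡ pendingCount W
  D≡p = distance≡pendingCount u v indᵤ indᵥ dist
  not-full : pendingCount W ≢ n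
  not-full p≡n = even≢odd (removeCount W) (suc k)
    (trans (double-removeCount W noClash (all-pending W p≡n)) (cong suc (sym (2*≡double (suc k)))))
  p≡n-1 : pendingCount W ≡ n ∸ 1
  p≡n-1 with m≤n⇒m<n∨m≡n (pendingCount-≤ W)
  ... | inj₁ p<n = ≤-antisym (≤-pred p<n) (≤-trans (diameter-≥-odd diam) (≤-reflexive D≡p))
  ... | inj₂ p≡n = ⊥-elim (not-full p≡n)

theorem2 : (n : ℕ) → 2 ≤ n → (u v : Vec Bool n) → Lucas u → Lucas v →
    (D : ℕ) → IsDiam n D → IsDist u v D →
    (∀ m → n ≡ 2 * m → numWalks D u v ≡ m * Euler (n ∸ 1)) ×
    (∀ m → n ≡ 2 * m + 1 → numWalks D u v ≡ Euler (n ∸ 1))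
theorem2 n 2≤n u v lᵤ lᵥ D diam dist = even , odd
  where
  even : ∀ m → n ≡ 2 * m → numWalks D u v ≡ m * Euler (n ∸ 1)
  even zero    n≡0 with () ← ≤-trans 2≤n (≤-reflexive n≡0)
  even (suc k) n≡2m = numWalks-diameter-even k (trans n≡2m (2*≡double (suc k))) u v lᵤ lᵥ D diam dist
  odd : ∀ m → n ≡ 2 * m + 1 → numWalks D u v ≡ Euler (n ∸ 1)
  odd zero    n≡1 = ⊥-elim (1+n≰n (≤-trans 2≤n (≤-reflexive n≡1)))
  odd (suc k) n≡2m+1 =
    numWalks-diameter-odd k (trans n≡2m+1 (trans (+-comm _ 1) (cong suc (2*≡double (suc k))))) u v lᵤ lᵥ D diam dist
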